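{- Let $T[0..n)$ be a text and $P[0..m)$ a pattern, and let $\mathsf{eMS}$ be the extended matching statistics of $P$ with respect to $T$. For $i\in[0..m)$ let $w_i=P[i..i+\mathsf{eMS}[i].\mathsf{len})$, and let $\mathcal{L}\subseteq[0..m)$ be the set of positions $i$ such that $w_i$ is a maximal match and occurs exactly once in $T$. Then for every $i\in\mathcal{L}$: $w_i$ is not unique in $P$ (i.e. occurs at more than one position of $P$) if and only if there exist $i'\in\mathcal{L}\setminus\{i\}$ and two possibly empty strings $u,v$ such that $w_{i'}=u\,w_i\,v$.
   Context: Strings are indexed from $0$; $S[i..j)=S[i]S[i+1]\cdots S[j-1]$ (empty if $i\ge j$). The text $T$ ends with a terminator $\$$ occurring nowhere else, lexicographically smallest. A match is a pair $(i,\ell)$ such that the factor $P[i..i+\ell)$ occurs in $T$; it is maximal if either $i=0$ or $P[i-1..i+\ell)$ does not occur in $T$, and either $i=m-\ell$ or $P[i..i+\ell+1)$ does not occur in $T$. The extended matching statistics $\mathsf{eMS}[0..m)$ is an array of triples $(\mathsf{pos},\mathsf{len},\mathsf{twice})$ such that for each $i$: $P[i..i+\mathsf{eMS}[i].\mathsf{len}) = T[\mathsf{eMS}[i].\mathsf{pos}..\mathsf{eMS}[i].\mathsf{pos}+\mathsf{eMS}[i].\mathsf{len})$; either $i=m-\mathsf{eMS}[i].\mathsf{len}$ or $P[i..i+\mathsf{eMS}[i].\mathsf{len}+1)$ does not occur in $T$; and $\mathsf{eMS}[i].\mathsf{twice}$ is the largest $\ell$ for which there exists a position $p\neq \mathsf{eMS}[i].\mathsf{pos}$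 with $P[i..i+\ell)=T[p..p+\ell)$. -}

module Defs where

open import Level using (Level)
open import Data.Nat using (ℕ; zero; suc; _+_; _∸_; _≤_; _<_)
open import Data.List using (List; []; _∷_; _++_; length; take; drop; [_])
open import Data.List.Membership.Propositional using (_∈_)
open import Data.Product using (Σ; ∃; ∃-syntax; _×_; _,_)
open import Data.Sum using (_⊎_)
open import Relation.Nullary using (¬_)
open import Relation.Binary.PropositionalEquality using (_≡_; _≢_)

private variable a : Level

factor : {A : Set a} → List A → ℕ → ℕ → List A
factor S i ℓ = take ℓ (drop i S)

OccAt : {A : Set a} → List A → List A → ℕ → Set a
OccAt S w p = (p + length w ≤ length S) × (factor S p (length w) ≡ w)

Occurs : {A : Set a} → List A → List A → Set a
Occurs S w = ∃[ p ] OccAt S w p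

OccursOnce : {A : Set a} → List A → List A → Set a
OccursOnce S w = ∃[ p ] (OccAt S w p × (∀ q → OccAt S w q → q ≡ p))

NotUnique : {A : Set a} → List A → List A → Set a
NotUnique S w = ∃[ p ] ∃[ q ] (p ≢ q × OccAt S w p × OccAt S w q)

IsText : {A : Set a} → (_<A_ : A → A → Set a) → A → List A → Set a
IsText {A = A} _<A_ $ T =
  (∃[ T' ] (T ≡ T' ++ [ $ ] × ¬ ($ ∈ T'))) × (∀ (c : A) → c ≢ $ → $ <A c)

Match : {A : Set a} → List A → List A → ℕ → ℕ → Set a
Match T P i ℓ = (i + ℓ ≤ length P) × Occurs T (factor P i ℓ)

MaximalMatch : {A : Set a} → List A → List A → ℕ → ℕ → Set a
MaximalMatch T P i ℓ =
  Match T P i ℓ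
  × ((i ≡ 0) ⊎ (Σ ℕ λ j → (i ≡ suc j) × ¬ Occurs T (factor P j (suc ℓ))))
  × ((i ≡ length P ∸ ℓ) ⊎ ¬ Occurs T (factor P i (suc ℓ)))

record Triple : Set where
  constructor triple
  field
    pos   : ℕ
    len   : ℕ
    twice : ℕ
open Triple public

IsEMS : {A : Set a} → List A → List A → (ℕ → Triple) → Set a
IsEMS T P e = ∀ i → i < length P →
  let t = e i in
    (i + len t ≤ length P)
  × (pos t + len t ≤ length T)
  × (factor P i (len t) ≡ factor T (pos t) (len t))
  × ((i ≡ length P ∸ len t) ⊎ ¬ Occurs T (factor P i (suc (len t))))
  × (∃[ p ] (p ≢ pos t × p + twice t ≤ length T × i + twice t ≤ length P
             × factor P i (twice t) ≡ factor T p (twice t)))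
  × (∀ ℓ p → p ≢ pos t → p + ℓ ≤ length T → i + ℓ ≤ length P
       → factor P i ℓ ≡ factor T p ℓ → ℓ ≤ twice t)

w : {A : Set a} → List A → (ℕ → Triple) → ℕ → List A
w P e i = factor P i (len (e i))

InL : {A : Set a} → List A → List A → (ℕ → Triple) → ℕ → Set a
InL T P e i = (i < length P) × MaximalMatch T P i (len (e i)) × OccursOnce T (w P e i)

-- (⇒) If w_i also occurs at j ≠ i, then eMS[j] reaches past that occurrence.
-- Walk left from j to the first position j′ of the run of positions whose eMS
-- match still reaches past it: eMS[j′-1] falls short, so the match at j′ cannot
-- be extended to the left, and eMS matches are right-maximal. Since w_j′
-- contains w_i, which occurs once in T, w_j′ occurs once as well; so j′ ∈ 𝓛,
-- and j′ ≠ i because the occurrences at i and j differ.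
--
-- (⇐) If w_i′ = u w_i v, then w_i occurs in P at i′ + |u|. Were that i, then u
-- would be nonempty (as i′ ≠ i) and w_i′ would extend the match at i to the
-- left inside T, against its left-maximality.
module Submission where

open import Defs
open import Level using (Level)
open import Data.Nat using (ℕ; zero; suc; _+_; _∸_; _⊓_; _≤_; _<_; z≤n; s≤s; _≤?_; _≟_)
open import Data.Nat.Properties
open import Data.List using (List; []; _∷_; _++_; length; take; drop)
open import Data.List.Properties using (length-++; length-take; length-drop; take-[]; take-take; take-drop; drop-drop)
open import Data.Product using (Σ; ∃-syntax; _×_; _,_; proj₁; proj₂)
open import Data.Sum using (_⊎_; inj₁; inj₂; map₂)
open import Data.Empty using (⊥; ⊥-elim)
open import Function using (_∘_)
open import Function.Bundles using (_⇔_; mk⇔)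
open import Relation.Nullary using (¬_; yes; no; contradiction)
open import Relation.Unary using (Pred; Decidable)
open import Relation.Binary.PropositionalEquality

private variable
  a p : Level
  A : Set a
  S T P u v x : List A
  e : ℕ → Triple
  i i′ ℓ ℓ′ q : ℕ

take-+ : ∀ m n (xs : List A) → take (m + n) xs ≡ take m xs ++ take n (drop m xs)
take-+ zero    n xs       = refl
take-+ (suc m) n []       = sym (take-[] n)
take-+ (suc m) n (y ∷ xs) = cong (y ∷_) (take-+ m n xs)

take-length-++ : ∀ (xs ys : List A) → take (length xs) (xs ++ ys) ≡ xs
take-length-++ []       ys = refl
take-length-++ (y ∷ xs) ys = cong (y ∷_) (take-length-++ xs ys)

drop-length-++ : ∀ (xs ys : List A) → drop (length xs) (xs ++ ys) ≡ ys
drop-length-++ []       ys = refl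
drop-length-++ (y ∷ xs) ys = drop-length-++ xs ys

take-drop-take : ∀ {k m ℓ} (xs : List A) → k + m ≤ ℓ →
                 take m (drop k (take ℓ xs)) ≡ take m (drop k xs)
take-drop-take {k = k} {m} {ℓ} xs k+m≤ℓ = begin
  take m (drop k (take ℓ xs))         ≡⟨ take-drop m k (take ℓ xs) ⟩
  drop k (take (k + m) (take ℓ xs))   ≡⟨ cong (drop k) (take-take (k + m) ℓ xs) ⟩
  drop k (take ((k + m) ⊓ ℓ) xs)      ≡⟨ cong (λ n → drop k (take n xs)) (m≤n⇒m⊓n≡m k+m≤ℓ) ⟩
  drop k (take (k + m) xs)            ≡⟨ take-drop m k xs ⟨
  take m (drop k xs)                  ∎
  where open ≡-Reasoning

length-infix : ∀ (u x v : List A) → length u + length x ≤ length (u ++ x ++ v)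
length-infix []      x v = subst (length x ≤_) (sym (length-++ x)) (m≤m+n (length x) (length v))
length-infix (_ ∷ u) x v = s≤s (length-infix u x v)

length-factor : ∀ (S : List A) → i + ℓ ≤ length S → length (factor S i ℓ) ≡ ℓ
length-factor {i = i} {ℓ} S i+ℓ≤ = begin
  length (take ℓ (drop i S))  ≡⟨ length-take ℓ (drop i S) ⟩
  ℓ ⊓ length (drop i S)       ≡⟨ cong (ℓ ⊓_) (length-drop i S) ⟩
  ℓ ⊓ (length S ∸ i)          ≡⟨ m≤n⇒m⊓n≡m (m+n≤o⇒m≤o∸n ℓ (subst (_≤ length S) (+-comm i ℓ) i+ℓ≤)) ⟩
  ℓ                           ∎
  where open ≡-Reasoning

factor-+ : ∀ (S : List A) i m n → factor S i (m + n) ≡ factor S i m ++ factor S (i + m) n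
factor-+ S i m n = begin
  take (m + n) (drop i S)                          ≡⟨ take-+ m n (drop i S) ⟩
  factor S i m ++ take n (drop m (drop i S))       ≡⟨ cong (λ s → factor S i m ++ take n s) (drop-drop i m S) ⟩
  factor S i m ++ factor S (i + m) n               ∎
  where open ≡-Reasoning

factor-infix : ∀ (S : List A) {i j m ℓ} → i ≤ j → j + m ≤ i + ℓ →
               factor S i ℓ ≡ factor S i (j ∸ i) ++ factor S j m ++ factor S (j + m) (i + ℓ ∸ (j + m))
factor-infix S {i} {j} {m} {ℓ} i≤j j+m≤ = begin
  factor S i ℓ                                    ≡⟨ cong (factor S i) ℓ-split ⟩
  factor S i (d + (m + r))                        ≡⟨ factor-+ S i d (m + r) ⟩
  factor S i d ++ factor S (i + d) (m + r)        ≡⟨ cong (λ n → factor S i d ++ factor S n (m + r)) i+d≡j ⟩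
  factor S i d ++ factor S j (m + r)              ≡⟨ cong (factor S i d ++_) (factor-+ S j m r) ⟩
  factor S i d ++ factor S j m ++ factor S (j + m) r ∎
  where
  open ≡-Reasoning
  d r : ℕ
  d = j ∸ i
  r = i + ℓ ∸ (j + m)
  i+d≡j : i + d ≡ j
  i+d≡j = m+[n∸m]≡n i≤j
  ℓ-split : ℓ ≡ d + (m + r)
  ℓ-split = +-cancelˡ-≡ i ℓ (d + (m + r)) (begin
    i + ℓ            ≡⟨ m+[n∸m]≡n j+m≤ ⟨
    j + m + r        ≡⟨ cong (λ n → n + m + r) i+d≡j ⟨
    i + d + m + r    ≡⟨ +-assoc (i + d) m r ⟩
    i + d + (m + r)  ≡⟨ +-assoc i d (m + r) ⟩
    i + (d + (m + r)) ∎)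

OccAt-self : ∀ (S : List A) → i + ℓ ≤ length S → OccAt S (factor S i ℓ) i
OccAt-self {i = i} {ℓ} S i+ℓ≤ =
  subst (λ n → i + n ≤ length S × factor S i n ≡ factor S i ℓ) (sym (length-factor S i+ℓ≤)) (i+ℓ≤ , refl)

OccAt-start< : 0 < length x → OccAt S x i → i < length S
OccAt-start< {i = i} 0<|x| (end≤ , _) = <-≤-trans (m<m+n i 0<|x|) end≤

OccAt-infix : ∀ (u x v : List A) → OccAt T (u ++ x ++ v) q → OccAt T x (q + length u)
OccAt-infix {T = T} {q = q} u x v (end≤ , factor≡) = end≤′ , (begin
  take (length x) (drop (q + length u) T)                ≡⟨ cong (take (length x)) (drop-drop q (length u) T) ⟨
  take (length x) (drop (length u) (drop q T))           ≡⟨ take-drop-take (drop q T) (length-infix u x v) ⟨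
  take (length x) (drop (length u) (factor T q (length (u ++ x ++ v))))
                                                         ≡⟨ cong (take (length x) ∘ drop (length u)) factor≡ ⟩
  take (length x) (drop (length u) (u ++ x ++ v))        ≡⟨ cong (take (length x)) (drop-length-++ u (x ++ v)) ⟩
  take (length x) (x ++ v)                               ≡⟨ take-length-++ x v ⟩
  x                                                      ∎)
  where
  open ≡-Reasoning
  end≤′ : q + length u + length x ≤ length T
  end≤′ = ≤-trans (≤-reflexive (+-assoc q (length u) (length x)))
                  (≤-trans (+-monoʳ-≤ q (length-infix u x v)) end≤)

Occurs-within : ∀ {T S : List A} {i j ℓ ℓ′} → i ≤ j → j + ℓ′ ≤ i + ℓ →
                Occurs T (factor S i ℓ) → Occurs T (factor S j ℓ′)
Occurs-within {T = T} {S} {i} {j} {ℓ} {ℓ′} i≤j j+ℓ′≤ (q , occ) =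
  _ , OccAt-infix (factor S i (j ∸ i)) (factor S j ℓ′) (factor S (j + ℓ′) (i + ℓ ∸ (j + ℓ′)))
                  (subst (λ y → OccAt T y q) (factor-infix S i≤j j+ℓ′≤) occ)

OccursOnce-infix : OccursOnce T x → OccAt T (u ++ x ++ v) q → OccursOnce T (u ++ x ++ v)
OccursOnce-infix {x = x} {u = u} {v} {q} (_ , _ , unique) occ =
  q , occ , λ q′ occ′ → +-cancelʳ-≡ (length u) q′ q
                          (trans (unique _ (OccAt-infix u x v occ′)) (sym (unique _ (OccAt-infix u x v occ))))

-- The empty word occurs at every position 0 … |T|.
OccursOnce-nonempty : 0 < length T → OccursOnce T x → 0 < length x
OccursOnce-nonempty {x = _ ∷ _} _       _                 = s≤s z≤n
OccursOnce-nonempty {x = []}    0<|T| (_ , _ , unique)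
  with trans (unique 0 (z≤n , refl)) (sym (unique 1 (0<|T| , refl)))
... | ()

IsText-nonempty : {_<A_ : A → A → Set a} {$ : A} → IsText _<A_ $ T → 0 < length T
IsText-nonempty ((T′ , refl , _) , _) = subst (0 <_) (sym (length-++ T′)) (m≤n+m 1 (length T′))

run-start : {Q : Pred ℕ p} → Decidable Q → ∀ {n} → Q n →
            ∃[ j ] (j ≤ n × Q j × (j ≡ 0 ⊎ ∃[ k ] (j ≡ suc k × ¬ Q k)))
run-start Q? {zero}  Qn = 0 , z≤n , Qn , inj₁ refl
run-start Q? {suc n} Qn with Q? n
... | no ¬Qn = suc n , ≤-refl , Qn , inj₂ (n , refl , ¬Qn)
... | yes Qn′ with run-start Q? Qn′
...   | j , j≤n , rest = j , m≤n⇒m≤1+n j≤n , rest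

LeftMaximal : List A → List A → ℕ → ℕ → Set _
LeftMaximal T P i ℓ = (i ≡ 0) ⊎ (Σ ℕ λ j → (i ≡ suc j) × ¬ Occurs T (factor P j (suc ℓ)))

leftMaximal-not-inside : LeftMaximal T P i ℓ → Occurs T (factor P i′ ℓ′) → i′ < i → i + ℓ ≤ i′ + ℓ′ → ⊥
leftMaximal-not-inside (inj₁ refl)              _   ()
leftMaximal-not-inside {ℓ = ℓ} {i′ = i′} {ℓ′ = ℓ′} (inj₂ (k , refl , ¬occ)) occ (s≤s i′≤k) end≤ =
  ¬occ (Occurs-within i′≤k (subst (_≤ i′ + ℓ′) (sym (+-suc k ℓ)) end≤) occ)

ems-OccAt : IsEMS T P e → i < length P → OccAt T (w P e i) (pos (e i))
ems-OccAt {P = P} {e = e} {i = i} ems i<m with ems i i<m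
... | end≤ , pos-end≤ , factor≡ , _ =
  subst (λ n → pos (e i) + n ≤ _ × factor _ (pos (e i)) n ≡ w P e i) (sym (length-factor P end≤))
        (pos-end≤ , sym factor≡)

ems-longest : IsEMS T P e → i < length P → i + ℓ ≤ length P → Occurs T (factor P i ℓ) → ℓ ≤ len (e i)
ems-longest {P = P} {e = e} {i = i} {ℓ} ems i<m end≤ occ with ℓ ≤? len (e i) | ems i i<m
... | yes ℓ≤ | _ = ℓ≤
... | no ℓ≰ | endᵢ≤ , _ , _ , inj₁ i≡ , _ =
  contradiction (+-cancelˡ-≤ i ℓ (len (e i)) (≤-trans end≤ (≤-reflexive (sym i+L≡m)))) ℓ≰
  where
  i+L≡m : i + len (e i) ≡ length P
  i+L≡m = trans (cong (_+ len (e i)) i≡) (m∸n+n≡m (m+n≤o⇒n≤o i endᵢ≤))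
... | no ℓ≰ | _ , _ , _ , inj₂ ¬occ , _ =
  contradiction (Occurs-within ≤-refl (+-monoʳ-≤ i (≰⇒> ℓ≰)) occ) ¬occ

ems-leftMaximal : IsEMS T P e → i < length P →
                  (i ≡ 0 ⊎ ∃[ k ] (i ≡ suc k × k + len (e k) < i + len (e i))) →
                  LeftMaximal T P i (len (e i))
ems-leftMaximal ems i<m (inj₁ i≡0) = inj₁ i≡0
ems-leftMaximal {P = P} {e = e} ems k+1<m (inj₂ (k , refl , ends<)) = inj₂ (k , refl , λ occ →
  <⇒≱ ends< (subst (_≤ k + len (e k)) (+-suc k L′)
                   (+-monoʳ-≤ k (ems-longest ems (<-trans (n<1+n k) k+1<m) end≤ occ))))
  where
  L′ : ℕ
  L′ = len (e (suc k))
  end≤ : k + suc L′ ≤ length P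
  end≤ = subst (_≤ length P) (sym (+-suc k L′)) (proj₁ (ems (suc k) k+1<m))

ems-maximalMatch : IsEMS T P e → i < length P →
                   (i ≡ 0 ⊎ ∃[ k ] (i ≡ suc k × k + len (e k) < i + len (e i))) →
                   MaximalMatch T P i (len (e i))
ems-maximalMatch {i = i} ems i<m start with ems i i<m
... | end≤ , _ , _ , rightMaximal , _ =
  (end≤ , _ , ems-OccAt ems i<m) , ems-leftMaximal ems i<m start , rightMaximal

InL-at-run-start : ∀ {T P : List A} {e x i j} → IsEMS T P e → OccursOnce T x → OccAt P x j → j < length P →
                   i ≤ j → j + length x ≤ i + len (e i) →
                   (i ≡ 0 ⊎ ∃[ k ] (i ≡ suc k × ¬ (j + length x ≤ k + len (e k)))) →
                   InL T P e i × ∃[ u ] ∃[ v ] (w P e i ≡ u ++ x ++ v)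
InL-at-run-start {A = A} {T} {P} {e} {x} {i} {j} ems once (_ , factor≡x) j<m i≤j covers start =
  (i<m , ems-maximalMatch ems i<m start′ , once′) , before , after , w≡
  where
  before after : List A
  before = factor P i (j ∸ i)
  after  = factor P (j + length x) (i + len (e i) ∸ (j + length x))
  i<m : i < length P
  i<m = ≤-<-trans i≤j j<m
  w≡ : w P e i ≡ before ++ x ++ after
  w≡ = trans (factor-infix P i≤j covers) (cong (λ y → before ++ y ++ after) factor≡x)
  once′ : OccursOnce T (w P e i)
  once′ = subst (OccursOnce T) (sym w≡)
                (OccursOnce-infix {u = before} {v = after} once
                                  (subst (λ y → OccAt T y (pos (e i))) w≡ (ems-OccAt ems i<m)))
  start′ : i ≡ 0 ⊎ ∃[ k ] (i ≡ suc k × k + len (e k) < i + len (e i))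
  start′ = map₂ (λ (k , i≡1+k , ¬covers) → k , i≡1+k , <-≤-trans (≰⇒> ¬covers) covers) start

InL-covering : ∀ {T P : List A} {e x j} → IsEMS T P e → OccursOnce T x → OccAt P x j → j < length P →
               ∃[ i ] (i ≤ j × j + length x ≤ i + len (e i)
                       × InL T P e i × ∃[ u ] ∃[ v ] (w P e i ≡ u ++ x ++ v))
InL-covering {T = T} {P} {e} {x} {j} ems once occ@(end≤ , factor≡x) j<m
  with run-start (λ i → j + length x ≤? i + len (e i)) (+-monoʳ-≤ j (ems-longest ems j<m end≤ occursₓ))
  where
  occursₓ : Occurs T (factor P j (length x))
  occursₓ = proj₁ once , subst (λ y → OccAt T y (proj₁ once)) (sym factor≡x) (proj₁ (proj₂ once))
... | i , i≤j , covers , start = i , i≤j , covers , InL-at-run-start ems once occ j<m i≤j covers start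

NotUnique-of-infix : ∀ {T P u v : List A} {i ℓ i′ ℓ′} → LeftMaximal T P i ℓ → i + ℓ ≤ length P →
                     Occurs T (factor P i′ ℓ′) → i′ + ℓ′ ≤ length P → i′ ≢ i →
                     factor P i′ ℓ′ ≡ u ++ factor P i ℓ ++ v → NotUnique P (factor P i ℓ)
NotUnique-of-infix {A = A} {T} {P} {u} {v} {i} {ℓ} {i′} {ℓ′} left end≤ occ′ end′≤ i′≢i w≡
  with i′ + length u ≟ i
... | no ≢i = i , i′ + length u , ≢i ∘ sym , OccAt-self P end≤ ,
              OccAt-infix u (factor P i ℓ) v (subst (λ y → OccAt P y i′) w≡ (OccAt-self P end′≤))
... | yes ≡i = ⊥-elim (leftMaximal-not-inside left occ′ i′<i covers)
  where
  open ≤-Reasoning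
  wᵢ : List A
  wᵢ = factor P i ℓ
  i′<i : i′ < i
  i′<i = ≤∧≢⇒< (subst (i′ ≤_) ≡i (m≤m+n i′ (length u))) i′≢i
  covers : i + ℓ ≤ i′ + ℓ′
  covers = begin
    i + ℓ                         ≡⟨ cong₂ _+_ ≡i (length-factor P end≤) ⟨
    i′ + length u + length wᵢ     ≡⟨ +-assoc i′ (length u) (length wᵢ) ⟩
    i′ + (length u + length wᵢ)   ≤⟨ +-monoʳ-≤ i′ (length-infix u wᵢ v) ⟩
    i′ + length (u ++ wᵢ ++ v)    ≡⟨ cong (λ y → i′ + length y) w≡ ⟨
    i′ + length (factor P i′ ℓ′)  ≡⟨ cong (i′ +_) (length-factor P end′≤) ⟩
    i′ + ℓ′                       ∎

lemma3 : {a : Level} {A : Set a} (_<A_ : A → A → Set a) ($ : A) (T P : List A)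
         (e : ℕ → Triple) → IsText _<A_ $ T → IsEMS T P e →
         ∀ i → InL T P e i →
         (NotUnique P (w P e i)
           ⇔ (∃[ i' ] (InL T P e i' × i' ≢ i
                 × ∃[ u ] ∃[ v ] (w P e i' ≡ u ++ w P e i ++ v))))
lemma3 _<A_ $ T P e text ems i (_ , ((endᵢ≤ , _) , leftᵢ , _) , onceᵢ) = mk⇔ to from
  where
  InfixOfAnother : Set _
  InfixOfAnother = ∃[ i′ ] (InL T P e i′ × i′ ≢ i × ∃[ u ] ∃[ v ] (w P e i′ ≡ u ++ w P e i ++ v))

  0<|wᵢ| : 0 < length (w P e i)
  0<|wᵢ| = OccursOnce-nonempty (IsText-nonempty {_<A_ = _<A_} text) onceᵢ

  elsewhere : ∀ {j} → j ≢ i → OccAt P (w P e i) j → InfixOfAnother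
  elsewhere {j} j≢i occ with InL-covering ems onceᵢ occ (OccAt-start< 0<|wᵢ| occ)
  ... | i′ , i′≤j , covers , inL , decomposition = i′ , inL , i′≢i , decomposition
    where
    i′≢i : i′ ≢ i
    i′≢i i′≡i = j≢i (≤-antisym j≤i (subst (_≤ j) i′≡i i′≤j))
      where
      j≤i : j ≤ i
      j≤i = +-cancelʳ-≤ (len (e i)) j i
              (subst₂ (λ n k → j + n ≤ k + len (e k)) (length-factor P endᵢ≤) i′≡i covers)

  to : NotUnique P (w P e i) → InfixOfAnother
  to (p , q , p≢q , occp , occq) with p ≟ i
  ... | yes refl = elsewhere (p≢q ∘ sym) occq
  ... | no p≢i = elsewhere p≢i occp

  from : InfixOfAnother → NotUnique P (w P e i)
  from (i′ , (_ , ((end′≤ , occ′) , _) , _) , i′≢i , u , v , w≡) =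
    NotUnique-of-infix {u = u} {v} leftᵢ endᵢ≤ occ′ end′≤ i′≢i w≡
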